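{- Let $G$ be a finite graph and $R(G)$ a residual graph of $G$. Then (i) the graph $G\setminus V(R(G))$ (obtained by deleting the vertices of $R(G)$) is a forest that has a unique perfect matching; and (ii) $G$ has a perfect matching if and only if $R(G)$ has a perfect matching.
   Context: All graphs are finite and simple. A pendant $P_2$ in a graph is a path $xy$ attached to the rest of the graph by a single edge, i.e. $x$ has degree $1$, its unique neighbor $y$ has degree $2$, and $y$ has exactly one other neighbor $z$; removing it deletes $x$ and $y$. If the current graph is itself $P_2$, it may also be removed, leaving the empty graph. The residual graph $R(G)$ is the graph obtained from $G$ by iteratively removing pendant $P_2$'s until no such path is present. The empty graph is regarded as having a (empty) perfect matching. -}

module Defs where

open import Data.Nat using (ℕ; _≤_)
open import Data.Bool using (Bool; true; false)
open import Data.Empty renaming (⊥ to Empty)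
open import Data.Fin using (Fin)
open import Data.Fin.Subset using (Subset; _∈_; _-_; ⊥; ⊤; ∁)
open import Data.List using (List; []; _∷_; _++_; [_]; length)
open import Data.List.Relation.Unary.Linked using (Linked)
open import Data.List.Relation.Unary.All using (All)
open import Data.List.Relation.Unary.Unique.Propositional using (Unique)
open import Data.Product using (Σ; ∃; ∃-syntax; _×_; _,_)
open import Data.Sum using (_⊎_)
open import Relation.Binary.PropositionalEquality using (_≡_; _≢_)
open import Relation.Binary.Construct.Closure.ReflexiveTransitive using (Star)
open import Relation.Nullary using (¬_)

record Graph (n : ℕ) : Set where
  field
    adj     : Fin n → Fin n → Bool
    sym     : ∀ u v → adj u v ≡ adj v u
    irrefl  : ∀ v → adj v v ≡ false

open Graph public

module _ {n : ℕ} (G : Graph n) where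

  Adj : Fin n → Fin n → Set
  Adj u v = adj G u v ≡ true

  -- One removal step on the induced subgraph G[S] (vertex subsets S of V(G)).
  data Step (S : Subset n) : Subset n → Set where
    pendant : (x y z : Fin n) → x ∈ S → y ∈ S → z ∈ S →
              Adj x y → Adj y z → z ≢ x →
              (∀ w → w ∈ S → Adj x w → w ≡ y) →
              (∀ w → w ∈ S → Adj y w → w ≡ x ⊎ w ≡ z) →
              Step S (S - x - y)
    wholeP2 : (x y : Fin n) → x ∈ S → y ∈ S → Adj x y →
              (∀ w → w ∈ S → w ≡ x ⊎ w ≡ y) →
              Step S ⊥

  IsResidual : Subset n → Set
  IsResidual R = Star Step ⊤ R × (∀ R′ → ¬ Step R R′)

  IsCycle : Subset n → List (Fin n) → Set
  IsCycle S [] = Empty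
  IsCycle S (x ∷ xs) =
    2 ≤ length xs × Unique (x ∷ xs) × All (_∈ S) (x ∷ xs) ×
    Linked Adj (x ∷ xs ++ [ x ])

  IsForest : Subset n → Set
  IsForest S = ∀ c → ¬ IsCycle S c

  IsPerfectMatching : Subset n → (Fin n → Fin n → Bool) → Set
  IsPerfectMatching S M =
    (∀ u v → M u v ≡ M v u) ×
    (∀ u v → M u v ≡ true → u ∈ S × v ∈ S × Adj u v) ×
    (∀ u → u ∈ S → ∃[ w ] (M u w ≡ true × (∀ w′ → M u w′ ≡ true → w′ ≡ w)))

  HasPerfectMatching : Subset n → Set
  HasPerfectMatching S = ∃[ M ] IsPerfectMatching S M

  HasUniquePerfectMatching : Subset n → Set
  HasUniquePerfectMatching S =
    ∃[ M ] (IsPerfectMatching S M ×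
            (∀ M′ → IsPerfectMatching S M′ → ∀ u v → M′ u v ≡ M u v))

-- Removing a pendant P₂ xy, where x is a leaf of the current graph, is harmless
-- for perfect matchings: every perfect matching must pair the leaf x with its only
-- neighbour y, so the perfect matchings of the graph before and after the removal
-- correspond by adding or deleting the edge xy.  By induction along the removal
-- sequence, the deleted vertices therefore carry exactly one perfect matching, and
-- the graph has a perfect matching iff the residual graph does.  They also carry no
-- cycle: x has one neighbour and y at most one among the vertices removed after
-- it, while every vertex of a cycle has two.
module Submission where

open import Defs hiding (sym)
open import Data.Bool using (Bool; true; false; _∧_; _∨_)
open import Data.Empty using (⊥-elim)
open import Data.Fin using (Fin; _≟_)
open import Data.Fin.Subset
  using (Subset; _∈_; _∉_; _⊆_; _∩_; _─_; _-_; ∁; ⊤; ⊥; ⁅_⁆)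
open import Data.Fin.Subset.Properties
  using (∉⊥; x∈⁅x⁆; x∈p∧x≢y⇒x∈p-y; p─q⊆p; x∉p⇒x∈∁p; x∈p∩q⁺; x∈p∩q⁻; p∩q⊆p;
         ∩-identityˡ; ∩-inverseʳ)
open import Data.List using (List; []; _∷_; _++_; [_]; _∷ʳ_; InitLast; _∷ʳ′_; initLast)
open import Data.List.Properties using (++-assoc)
open import Data.List.Membership.Propositional using () renaming (_∈_ to _∈ₗ_)
open import Data.List.Membership.Propositional.Properties using (∈-∃++; ∈-++⁺ʳ)
import Data.List.Membership.DecPropositional as DecMembership
open import Data.List.Relation.Unary.Any using (here; there)
open import Data.List.Relation.Unary.All as All using (_∷_)
open import Data.List.Relation.Unary.Linked as Linked using (Linked; [-]; _∷_)
open import Data.List.Relation.Unary.AllPairs using (_∷_)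
open import Data.List.Relation.Binary.Permutation.Propositional using (_↭_; ↭-sym; ↭⇒↭ₛ)
open import Data.List.Relation.Binary.Permutation.Propositional.Properties
  using (++-comm; ↭-length; ∈-resp-↭; All-resp-↭)
open import Data.Nat using (ℕ; _≤_; s≤s)
open import Data.Nat.Properties using (suc-injective)
open import Data.Product using (_×_; _,_; proj₁; proj₂; ∃₂; ∃-syntax)
open import Data.Sum using (_⊎_; inj₁; inj₂)
open import Data.Vec using (lookup)
open import Data.Vec.Properties using ([]=⇒lookup; lookup⇒[]=)
open import Function.Bundles using (_⇔_; mk⇔)
open import Function.Construct.Composition using (_⇔-∘_)
open import Function.Construct.Identity using (⇔-id)
open import Relation.Binary.PropositionalEquality
  using (_≡_; _≢_; refl; sym; trans; cong; cong₂; subst; module ≡-Reasoning)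
import Relation.Binary.PropositionalEquality.Properties as ≡
open import Relation.Binary.Construct.Closure.ReflexiveTransitive using (Star; ε; _◅_)
open import Relation.Nullary using (¬_; Dec; yes; no; does; _×-dec_; _⊎-dec_)
open import Relation.Nullary.Decidable using (dec-true)

≡true-ext : ∀ {a b : Bool} → (a ≡ true → b ≡ true) → (b ≡ true → a ≡ true) → a ≡ b
≡true-ext {false} {false} _ _ = refl
≡true-ext {false} {true}  _ b⇒a = b⇒a refl
≡true-ext {true}  {false} a⇒b _ = sym (a⇒b refl)
≡true-ext {true}  {true}  _ _ = refl

∧-≡true⁻ : ∀ {a b} → a ∧ b ≡ true → a ≡ true × b ≡ true
∧-≡true⁻ {true} b≡true = refl , b≡true

∧-≡true⁺ : ∀ {a b} → a ≡ true → b ≡ true → a ∧ b ≡ true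
∧-≡true⁺ refl b≡true = b≡true

∨-≡true⁻ : ∀ {a b} → a ∨ b ≡ true → a ≡ true ⊎ b ≡ true
∨-≡true⁻ {true}  _ = inj₁ refl
∨-≡true⁻ {false} b≡true = inj₂ b≡true

∨-≡trueˡ : ∀ {a} b → a ≡ true → a ∨ b ≡ true
∨-≡trueˡ b refl = refl

∨-≡trueʳ : ∀ a {b} → b ≡ true → a ∨ b ≡ true
∨-≡trueʳ true  _ = refl
∨-≡trueʳ false b≡true = b≡true

does-≡true⇒ : ∀ {A : Set} (a? : Dec A) → does a? ≡ true → A
does-≡true⇒ (yes a) _ = a

module _ where
  open import Data.Vec using (_∷_; there)

  x∈p─q⇒x∉q : ∀ {n} {x : Fin n} (p q : Subset n) → x ∈ p ─ q → x ∉ q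
  x∈p─q⇒x∉q (_ ∷ p) (_ ∷ q) (there x∈) (there x∈q) = x∈p─q⇒x∉q p q x∈ x∈q

  x∈p-y⇒x≢y : ∀ {n} {x y : Fin n} (p : Subset n) → x ∈ p - y → x ≢ y
  x∈p-y⇒x≢y {x = x} p x∈ refl = x∈p─q⇒x∉q p ⁅ x ⁆ x∈ (x∈⁅x⁆ x)

module _ {A : Set} {R : A → A → Set} where

  Linked-++⁻ : ∀ xs {y ys} → Linked R (xs ++ y ∷ ys) → Linked R (xs ∷ʳ y) × Linked R (y ∷ ys)
  Linked-++⁻ []            linked          = [-] , linked
  Linked-++⁻ (x ∷ [])      (r ∷ linked)    = r ∷ [-] , linked
  Linked-++⁻ (x ∷ x′ ∷ xs) (r ∷ linked)    =
    let (front , back) = Linked-++⁻ (x′ ∷ xs) linked in r ∷ front , back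

  Linked-++⁺ : ∀ xs {y ys} → Linked R (xs ∷ʳ y) → Linked R (y ∷ ys) → Linked R (xs ++ y ∷ ys)
  Linked-++⁺ []            _            back = back
  Linked-++⁺ (x ∷ [])      (r ∷ [-])    back = r ∷ back
  Linked-++⁺ (x ∷ x′ ∷ xs) (r ∷ front)  back = r ∷ Linked-++⁺ (x′ ∷ xs) front back

  Linked-rotate : ∀ x p v q → Linked R ((x ∷ p ++ v ∷ q) ∷ʳ x) → Linked R ((v ∷ q ++ x ∷ p) ∷ʳ v)
  Linked-rotate x p v q linked =
    let (x⋯v , v⋯x) = Linked-++⁻ (x ∷ p)
                        (subst (Linked R) (cong (x ∷_) (++-assoc p (v ∷ q) [ x ])) linked)
    in subst (Linked R) (cong (v ∷_) (sym (++-assoc q (x ∷ p) [ v ])))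
         (Linked-++⁺ (v ∷ q) v⋯x x⋯v)

EdgeSet : ℕ → Set
EdgeSet n = Fin n → Fin n → Bool

module _ {n : ℕ} where

  _∪ᴱ_ : EdgeSet n → EdgeSet n → EdgeSet n
  (M ∪ᴱ N) u v = M u v ∨ N u v

  -- Opaque, so that the arguments stay inferable from hypotheses such as edgeᴱ x y u v ≡ true.
  opaque
    _↾_ : EdgeSet n → Subset n → EdgeSet n
    (M ↾ T) u v = lookup T u ∧ M u v

    ↾-≡true⁻ : ∀ {M T u v} → (M ↾ T) u v ≡ true → u ∈ T × M u v ≡ true
    ↾-≡true⁻ {T = T} {u} e = let (Tu , Muv) = ∧-≡true⁻ e in lookup⇒[]= u T Tu , Muv

    ↾-≡true⁺ : ∀ {M T u v} → u ∈ T → M u v ≡ true → (M ↾ T) u v ≡ true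
    ↾-≡true⁺ u∈T Muv = ∧-≡true⁺ ([]=⇒lookup u∈T) Muv

    edgeᴱ : Fin n → Fin n → EdgeSet n
    edgeᴱ x y u v = does ((u ≟ x ×-dec v ≟ y) ⊎-dec (u ≟ y ×-dec v ≟ x))

    edgeᴱ-≡true⁻ : ∀ {x y u v} → edgeᴱ x y u v ≡ true → (u ≡ x × v ≡ y) ⊎ (u ≡ y × v ≡ x)
    edgeᴱ-≡true⁻ {x} {y} {u} {v} = does-≡true⇒ ((u ≟ x ×-dec v ≟ y) ⊎-dec (u ≟ y ×-dec v ≟ x))

    edgeᴱ-≡true⁺ : ∀ {x y u v} → (u ≡ x × v ≡ y) ⊎ (u ≡ y × v ≡ x) → edgeᴱ x y u v ≡ true
    edgeᴱ-≡true⁺ {x} {y} {u} {v} = dec-true ((u ≟ x ×-dec v ≟ y) ⊎-dec (u ≟ y ×-dec v ≟ x))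

  edgeᴱ-sym : ∀ x y u v → edgeᴱ x y u v ≡ edgeᴱ x y v u
  edgeᴱ-sym x y u v = ≡true-ext flip flip
    where
      flip : ∀ {u v} → edgeᴱ x y u v ≡ true → edgeᴱ x y v u ≡ true
      flip e with edgeᴱ-≡true⁻ e
      ... | inj₁ (u≡x , v≡y) = edgeᴱ-≡true⁺ (inj₂ (v≡y , u≡x))
      ... | inj₂ (u≡y , v≡x) = edgeᴱ-≡true⁺ (inj₁ (v≡x , u≡y))

module _ {n : ℕ} (G : Graph n) where

  open DecMembership (_≟_ {n}) using (_∈?_)
  open import Data.List.Relation.Binary.Permutation.Setoid.Properties (≡.setoid (Fin n))
    using (Unique-resp-↭)

  private
    variable
      S S′ T R : Subset n
      a b u v w x y : Fin n
      c : List (Fin n)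

  Adj-sym : Adj G u v → Adj G v u
  Adj-sym {u} {v} u~v = trans (Graph.sym G v u) u~v

  Adj-irrefl : ¬ Adj G v v
  Adj-irrefl {v} v~v with trans (sym (irrefl G v)) v~v
  ... | ()

  Adj⇒≢ : Adj G u v → u ≢ v
  Adj⇒≢ u~v refl = Adj-irrefl u~v

  Degree≤1 : Subset n → Fin n → Set
  Degree≤1 S y = ∀ {a b} → a ∈ S → b ∈ S → Adj G y a → Adj G y b → a ≡ b

  Degree≤1-anti : T ⊆ S → Degree≤1 S y → Degree≤1 T y
  Degree≤1-anti T⊆S deg a∈T b∈T = deg (T⊆S a∈T) (T⊆S b∈T)

  HasTwoNeighboursIn : List (Fin n) → Fin n → Set
  HasTwoNeighboursIn c v = ∃₂ λ a b → a ≢ b × a ∈ₗ c × b ∈ₗ c × Adj G v a × Adj G v b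

  HasTwoNeighboursIn-mono : ∀ {c c′} → (∀ {a} → a ∈ₗ c → a ∈ₗ c′) →
                            HasTwoNeighboursIn c v → HasTwoNeighboursIn c′ v
  HasTwoNeighboursIn-mono c⊆c′ (a , b , a≢b , a∈c , b∈c , v~a , v~b) =
    a , b , a≢b , c⊆c′ a∈c , c⊆c′ b∈c , v~a , v~b

  cycle-⊆ : IsCycle G S c → v ∈ₗ c → v ∈ S
  cycle-⊆ {c = _ ∷ _} (_ , _ , all , _) v∈c = All.lookup all v∈c

  cycle-mono : (∀ {v} → v ∈ₗ c → v ∈ T) → IsCycle G S c → IsCycle G T c
  cycle-mono {c = _ ∷ _} c⊆T (len , unique , _ , linked) = len , unique , All.tabulate c⊆T , linked

  cycle-rotate : ∀ x p v q → IsCycle G S (x ∷ p ++ v ∷ q) → IsCycle G S (v ∷ q ++ x ∷ p)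
  cycle-rotate x p v q (len , unique , all , linked) =
    subst (2 ≤_) (suc-injective (↭-length rotation)) len ,
    Unique-resp-↭ (↭⇒↭ₛ rotation) unique ,
    All-resp-↭ rotation all ,
    Linked-rotate x p v q linked
    where
      rotation : x ∷ p ++ v ∷ q ↭ v ∷ q ++ x ∷ p
      rotation = ++-comm (x ∷ p) (v ∷ q)

  private
    cycle-first-neighbours : ∀ v a rest → InitLast rest → IsCycle G S (v ∷ a ∷ rest) →
                             HasTwoNeighboursIn (v ∷ a ∷ rest) v
    cycle-first-neighbours v a .[] [] (s≤s () , _)
    cycle-first-neighbours v a .(r ∷ʳ b) (r ∷ʳ′ b) (_ , (_ ∷ a∉rest ∷ _) , _ , v~a ∷ linked) =
      a , b , All.lookup a∉rest b∈rest , there (here refl) , there (there b∈rest) ,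
      v~a , Adj-sym b~v
      where
        b∈rest : b ∈ₗ r ∷ʳ b
        b∈rest = ∈-++⁺ʳ r (here refl)
        b~v : Adj G b v
        b~v = Linked.head (proj₂ (Linked-++⁻ (a ∷ r)
                (subst (Linked (Adj G)) (cong (a ∷_) (++-assoc r [ b ] [ v ])) linked)))

  cycle-head-neighbours : ∀ xs → IsCycle G S (v ∷ xs) → HasTwoNeighboursIn (v ∷ xs) v
  cycle-head-neighbours []           (() , _)
  cycle-head-neighbours (a ∷ rest) cycle = cycle-first-neighbours _ a rest (initLast rest) cycle

  cycle-neighbours : IsCycle G S c → v ∈ₗ c → HasTwoNeighboursIn c v
  cycle-neighbours {c = v ∷ xs} cycle (here refl) = cycle-head-neighbours xs cycle
  cycle-neighbours {c = x ∷ xs} {v = v} cycle (there v∈xs) with ∈-∃++ v∈xs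
  ... | p , q , refl =
    HasTwoNeighboursIn-mono (∈-resp-↭ (↭-sym (++-comm (x ∷ p) (v ∷ q))))
      (cycle-head-neighbours (q ++ x ∷ p) (cycle-rotate x p v q cycle))

  partner-unique : ∀ {M} → IsPerfectMatching G S M → M u v ≡ true → M u w ≡ true → v ≡ w
  partner-unique (_ , edge , partner) Muv Muw =
    let (_ , _ , unique) = partner _ (proj₁ (edge _ _ Muv))
    in trans (unique _ Muv) (sym (unique _ Muw))

  ↾-isPerfectMatching : ∀ {M} → IsPerfectMatching G S M → T ⊆ S →
                        (∀ {u v} → u ∈ T → M u v ≡ true → v ∈ T) →
                        IsPerfectMatching G T (M ↾ T)
  ↾-isPerfectMatching {S} {T} {M} (M-sym , edge , partner) T⊆S closed =
    (λ u v → ≡true-ext flip flip) , edge↾ , partner↾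
    where
      flip : ∀ {u v} → (M ↾ T) u v ≡ true → (M ↾ T) v u ≡ true
      flip {u} {v} e =
        let (u∈T , Muv) = ↾-≡true⁻ e in ↾-≡true⁺ (closed u∈T Muv) (trans (M-sym v u) Muv)
      edge↾ : ∀ u v → (M ↾ T) u v ≡ true → u ∈ T × v ∈ T × Adj G u v
      edge↾ u v e =
        let (u∈T , Muv) = ↾-≡true⁻ e in u∈T , closed u∈T Muv , proj₂ (proj₂ (edge u v Muv))
      partner↾ : ∀ u → u ∈ T →
                 ∃[ w ] ((M ↾ T) u w ≡ true × (∀ w′ → (M ↾ T) u w′ ≡ true → w′ ≡ w))
      partner↾ u u∈T =
        let (w , Muw , unique) = partner u (T⊆S u∈T)
        in w , ↾-≡true⁺ u∈T Muw , λ w′ e → unique w′ (proj₂ (↾-≡true⁻ e))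

  record LeafEdgeRemoval (S S′ : Subset n) (x y : Fin n) : Set where
    field
      x∈S  : x ∈ S
      y∈S  : y ∈ S
      x~y  : Adj G x y
      leaf : ∀ {w} → w ∈ S → Adj G x w → w ≡ y
      S′⊆S : S′ ⊆ S
      x∉S′ : x ∉ S′
      y∉S′ : y ∉ S′
      ∈S′⁺ : ∀ {v} → v ∈ S → v ≢ x → v ≢ y → v ∈ S′

    x≢y : x ≢ y
    x≢y = Adj⇒≢ x~y

    ∈S-cases : v ∈ S → v ≡ x ⊎ v ≡ y ⊎ v ∈ S′
    ∈S-cases {v} v∈S with v ≟ x | v ≟ y
    ... | yes v≡x | _       = inj₁ v≡x
    ... | no _    | yes v≡y = inj₂ (inj₁ v≡y)
    ... | no v≢x  | no v≢y  = inj₂ (inj₂ (∈S′⁺ v∈S v≢x v≢y))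

  step⇒removal : Step G S S′ → ∃₂ λ x y → LeafEdgeRemoval S S′ x y × Degree≤1 S′ y
  step⇒removal {S} (pendant x y z x∈S y∈S _ x~y _ _ x-leaf y-neighbours) =
    x , y ,
    record
      { x∈S = x∈S ; y∈S = y∈S ; x~y = x~y ; leaf = x-leaf _
      ; S′⊆S = λ v∈ → p─q⊆p S _ (p─q⊆p (S - x) _ v∈)
      ; x∉S′ = λ x∈ → ≢x x∈ refl
      ; y∉S′ = λ y∈ → x∈p-y⇒x≢y (S - x) y∈ refl
      ; ∈S′⁺ = λ v∈S v≢x v≢y → x∈p∧x≢y⇒x∈p-y (x∈p∧x≢y⇒x∈p-y v∈S v≢x) v≢y } ,
    λ a∈ b∈ y~a y~b → trans (≡z a∈ y~a) (sym (≡z b∈ y~b))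
    where
      ≢x : v ∈ S - x - y → v ≢ x
      ≢x v∈ = x∈p-y⇒x≢y S (p─q⊆p (S - x) _ v∈)
      ≡z : v ∈ S - x - y → Adj G y v → v ≡ z
      ≡z v∈ y~v with y-neighbours _ (p─q⊆p S _ (p─q⊆p (S - x) _ v∈)) y~v
      ... | inj₁ v≡x = ⊥-elim (≢x v∈ v≡x)
      ... | inj₂ v≡z = v≡z
  step⇒removal {S} (wholeP2 x y x∈S y∈S x~y only-x-y) =
    x , y ,
    record
      { x∈S = x∈S ; y∈S = y∈S ; x~y = x~y
      ; leaf = leaf
      ; S′⊆S = λ v∈⊥ → ⊥-elim (∉⊥ v∈⊥)
      ; x∉S′ = ∉⊥
      ; y∉S′ = ∉⊥
      ; ∈S′⁺ = ∈⊥ } ,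
    λ a∈⊥ _ _ _ → ⊥-elim (∉⊥ a∈⊥)
    where
      leaf : w ∈ S → Adj G x w → w ≡ y
      leaf w∈S x~w with only-x-y _ w∈S
      ... | inj₁ refl = ⊥-elim (Adj-irrefl x~w)
      ... | inj₂ w≡y  = w≡y
      ∈⊥ : v ∈ S → v ≢ x → v ≢ y → v ∈ ⊥
      ∈⊥ v∈S v≢x v≢y with only-x-y _ v∈S
      ... | inj₁ v≡x = ⊥-elim (v≢x v≡x)
      ... | inj₂ v≡y = ⊥-elim (v≢y v≡y)

  removal-∩ : LeafEdgeRemoval S S′ x y → x ∈ T → y ∈ T → LeafEdgeRemoval (S ∩ T) (S′ ∩ T) x y
  removal-∩ {S} {S′} {T = T} r x∈T y∈T = record
    { x∈S  = x∈p∩q⁺ (x∈S , x∈T)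
    ; y∈S  = x∈p∩q⁺ (y∈S , y∈T)
    ; x~y  = x~y
    ; leaf = λ w∈ → leaf (proj₁ (x∈p∩q⁻ S T w∈))
    ; S′⊆S = λ v∈ → let (v∈S′ , v∈T) = x∈p∩q⁻ S′ T v∈ in x∈p∩q⁺ (S′⊆S v∈S′ , v∈T)
    ; x∉S′ = λ x∈ → x∉S′ (proj₁ (x∈p∩q⁻ S′ T x∈))
    ; y∉S′ = λ y∈ → y∉S′ (proj₁ (x∈p∩q⁻ S′ T y∈))
    ; ∈S′⁺ = λ v∈ v≢x v≢y → let (v∈S , v∈T) = x∈p∩q⁻ S T v∈ in x∈p∩q⁺ (∈S′⁺ v∈S v≢x v≢y , v∈T) }
    where open LeafEdgeRemoval r

  forest-extend : LeafEdgeRemoval S S′ x y → Degree≤1 S′ y → IsForest G S′ → IsForest G S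
  forest-extend {S′ = S′} {x = x} {y} r deg forest c cycle with x ∈? c | y ∈? c
  ... | yes x∈c | _ =
    let (a , b , a≢b , a∈c , b∈c , x~a , x~b) = cycle-neighbours cycle x∈c
    in a≢b (trans (leaf (cycle-⊆ cycle a∈c) x~a) (sym (leaf (cycle-⊆ cycle b∈c) x~b)))
    where open LeafEdgeRemoval r
  ... | no x∉c | yes y∈c =
    let (a , b , a≢b , a∈c , b∈c , y~a , y~b) = cycle-neighbours cycle y∈c
    in a≢b (deg (∈S′ a∈c (Adj⇒≢ (Adj-sym y~a))) (∈S′ b∈c (Adj⇒≢ (Adj-sym y~b))) y~a y~b)
    where
      open LeafEdgeRemoval r
      ∈S′ : v ∈ₗ c → v ≢ y → v ∈ S′
      ∈S′ v∈c = ∈S′⁺ (cycle-⊆ cycle v∈c) (λ { refl → x∉c v∈c })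
  ... | no x∉c | no y∉c =
    forest c (cycle-mono (λ v∈c → ∈S′⁺ (cycle-⊆ cycle v∈c) (λ { refl → x∉c v∈c })
                                                           (λ { refl → y∉c v∈c }))
                         cycle)
    where open LeafEdgeRemoval r

  module _ (r : LeafEdgeRemoval S S′ x y) where
    open LeafEdgeRemoval r

    module _ {M} (pm : IsPerfectMatching G S M) where
      private
        M-sym = proj₁ pm
        edge = proj₁ (proj₂ pm)

      leaf-partner : M x w ≡ true → w ≡ y
      leaf-partner Mxw = let (_ , w∈S , x~w) = edge _ _ Mxw in leaf w∈S x~w

      leaf-matched : M x y ≡ true
      leaf-matched =
        let (w , Mxw , _) = proj₂ (proj₂ pm) x x∈S
        in subst (λ w → M x w ≡ true) (leaf-partner Mxw) Mxw

      neighbour-partner : M y w ≡ true → w ≡ x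
      neighbour-partner Myw = partner-unique pm Myw (trans (M-sym y x) leaf-matched)

      S′-closed : u ∈ S′ → M u v ≡ true → v ∈ S′
      S′-closed {u} {v} u∈S′ Muv with ∈S-cases (proj₁ (proj₂ (edge u v Muv)))
      ... | inj₁ refl =
        ⊥-elim (y∉S′ (subst (_∈ S′) (leaf-partner (trans (M-sym x u) Muv)) u∈S′))
      ... | inj₂ (inj₁ refl) =
        ⊥-elim (x∉S′ (subst (_∈ S′) (neighbour-partner (trans (M-sym y u) Muv)) u∈S′))
      ... | inj₂ (inj₂ v∈S′) = v∈S′

      restrict-isPerfectMatching : IsPerfectMatching G S′ (M ↾ S′)
      restrict-isPerfectMatching = ↾-isPerfectMatching pm S′⊆S S′-closed

      isPerfectMatching-decomposes : ∀ u v → M u v ≡ (edgeᴱ x y ∪ᴱ (M ↾ S′)) u v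
      isPerfectMatching-decomposes u v = ≡true-ext to from
        where
          to : M u v ≡ true → (edgeᴱ x y ∪ᴱ (M ↾ S′)) u v ≡ true
          to Muv with ∈S-cases (proj₁ (edge u v Muv))
          ... | inj₁ refl        = ∨-≡trueˡ _ (edgeᴱ-≡true⁺ (inj₁ (refl , leaf-partner Muv)))
          ... | inj₂ (inj₁ refl) = ∨-≡trueˡ _ (edgeᴱ-≡true⁺ (inj₂ (refl , neighbour-partner Muv)))
          ... | inj₂ (inj₂ u∈S′) = ∨-≡trueʳ _ (↾-≡true⁺ u∈S′ Muv)
          from : (edgeᴱ x y ∪ᴱ (M ↾ S′)) u v ≡ true → M u v ≡ true
          from e with ∨-≡true⁻ e
          ... | inj₂ restricted = proj₂ (↾-≡true⁻ restricted)
          ... | inj₁ xy with edgeᴱ-≡true⁻ xy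
          ...   | inj₁ (refl , refl) = leaf-matched
          ...   | inj₂ (refl , refl) = trans (M-sym y x) leaf-matched

    module _ {M′} (pm′ : IsPerfectMatching G S′ M′) where
      private
        edge′ = proj₁ (proj₂ pm′)

        edge-cases : (edgeᴱ x y ∪ᴱ M′) u v ≡ true →
                     (u ≡ x × v ≡ y) ⊎ (u ≡ y × v ≡ x) ⊎ (u ∈ S′ × M′ u v ≡ true)
        edge-cases e with ∨-≡true⁻ e
        ... | inj₂ M′uv = inj₂ (inj₂ (proj₁ (edge′ _ _ M′uv) , M′uv))
        ... | inj₁ xy with edgeᴱ-≡true⁻ xy
        ...   | inj₁ x→y = inj₁ x→y
        ...   | inj₂ y→x = inj₂ (inj₁ y→x)

      extend-isPerfectMatching : IsPerfectMatching G S (edgeᴱ x y ∪ᴱ M′)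
      extend-isPerfectMatching =
        (λ u v → cong₂ _∨_ (edgeᴱ-sym x y u v) (proj₁ pm′ u v)) , edge , partner
        where
          edge : ∀ u v → (edgeᴱ x y ∪ᴱ M′) u v ≡ true → u ∈ S × v ∈ S × Adj G u v
          edge u v e with edge-cases e
          ... | inj₁ (refl , refl)        = x∈S , y∈S , x~y
          ... | inj₂ (inj₁ (refl , refl)) = y∈S , x∈S , Adj-sym x~y
          ... | inj₂ (inj₂ (_ , M′uv))    =
            let (u∈S′ , v∈S′ , u~v) = edge′ u v M′uv in S′⊆S u∈S′ , S′⊆S v∈S′ , u~v
          partner : ∀ u → u ∈ S → ∃[ w ] ((edgeᴱ x y ∪ᴱ M′) u w ≡ true ×
                                          (∀ w′ → (edgeᴱ x y ∪ᴱ M′) u w′ ≡ true → w′ ≡ w))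
          partner u u∈S with ∈S-cases u∈S
          ... | inj₁ refl = y , ∨-≡trueˡ _ (edgeᴱ-≡true⁺ (inj₁ (refl , refl))) , only-y
            where
              only-y : ∀ w → (edgeᴱ x y ∪ᴱ M′) x w ≡ true → w ≡ y
              only-y w e with edge-cases e
              ... | inj₁ (_ , w≡y)           = w≡y
              ... | inj₂ (inj₁ (x≡y , _))    = ⊥-elim (x≢y x≡y)
              ... | inj₂ (inj₂ (x∈S′ , _))   = ⊥-elim (x∉S′ x∈S′)
          ... | inj₂ (inj₁ refl) = x , ∨-≡trueˡ _ (edgeᴱ-≡true⁺ (inj₂ (refl , refl))) , only-x
            where
              only-x : ∀ w → (edgeᴱ x y ∪ᴱ M′) y w ≡ true → w ≡ x
              only-x w e with edge-cases e
              ... | inj₁ (y≡x , _)           = ⊥-elim (x≢y (sym y≡x))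
              ... | inj₂ (inj₁ (_ , w≡x))    = w≡x
              ... | inj₂ (inj₂ (y∈S′ , _))   = ⊥-elim (y∉S′ y∈S′)
          ... | inj₂ (inj₂ u∈S′) with proj₂ (proj₂ pm′) u u∈S′
          ...   | w , M′uw , unique′ = w , ∨-≡trueʳ _ M′uw , only-w
            where
              only-w : ∀ w′ → (edgeᴱ x y ∪ᴱ M′) u w′ ≡ true → w′ ≡ w
              only-w w′ e with edge-cases e
              ... | inj₁ (u≡x , _)          = ⊥-elim (x∉S′ (subst (_∈ S′) u≡x u∈S′))
              ... | inj₂ (inj₁ (u≡y , _))   = ⊥-elim (y∉S′ (subst (_∈ S′) u≡y u∈S′))
              ... | inj₂ (inj₂ (_ , M′uw′)) = unique′ w′ M′uw′

    removal-hasPerfectMatching⇔ : HasPerfectMatching G S ⇔ HasPerfectMatching G S′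
    removal-hasPerfectMatching⇔ =
      mk⇔ (λ (M , pm) → M ↾ S′ , restrict-isPerfectMatching pm)
          (λ (M′ , pm′) → edgeᴱ x y ∪ᴱ M′ , extend-isPerfectMatching pm′)

    removal-hasUniquePerfectMatching : HasUniquePerfectMatching G S′ → HasUniquePerfectMatching G S
    removal-hasUniquePerfectMatching (M′ , pm′ , unique′) =
      edgeᴱ x y ∪ᴱ M′ , extend-isPerfectMatching pm′ , λ M pm u v → begin
        M u v                         ≡⟨ isPerfectMatching-decomposes pm u v ⟩
        edgeᴱ x y u v ∨ (M ↾ S′) u v  ≡⟨ cong (edgeᴱ x y u v ∨_)
                                              (unique′ _ (restrict-isPerfectMatching pm) u v) ⟩
        edgeᴱ x y u v ∨ M′ u v        ∎
      where open ≡-Reasoning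

  ⊥-isForest : IsForest G ⊥
  ⊥-isForest (v ∷ _) (_ , _ , v∈⊥ ∷ _ , _) = ∉⊥ v∈⊥

  ⊥-hasUniquePerfectMatching : HasUniquePerfectMatching G ⊥
  ⊥-hasUniquePerfectMatching =
    (λ _ _ → false) ,
    ((λ _ _ → refl) , (λ _ _ ()) , (λ _ u∈⊥ → ⊥-elim (∉⊥ u∈⊥))) ,
    λ M (_ , edge , _) u v → ≡true-ext (λ Muv → ⊥-elim (∉⊥ (proj₁ (edge u v Muv)))) (λ ())

  reduction-⊆ : Star (Step G) S R → R ⊆ S
  reduction-⊆ ε = λ v∈ → v∈
  reduction-⊆ (step ◅ steps) =
    let (_ , _ , r , _) = step⇒removal step
    in λ v∈R → LeafEdgeRemoval.S′⊆S r (reduction-⊆ steps v∈R)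

  reduction-hasPerfectMatching⇔ : Star (Step G) S R → HasPerfectMatching G S ⇔ HasPerfectMatching G R
  reduction-hasPerfectMatching⇔ ε = ⇔-id _
  reduction-hasPerfectMatching⇔ (step ◅ steps) =
    let (_ , _ , r , _) = step⇒removal step
    in reduction-hasPerfectMatching⇔ steps ⇔-∘ removal-hasPerfectMatching⇔ r

  step⇒removal-outside : Step G S S′ → R ⊆ S′ →
    ∃₂ λ x y → LeafEdgeRemoval (S ∩ ∁ R) (S′ ∩ ∁ R) x y × Degree≤1 (S′ ∩ ∁ R) y
  step⇒removal-outside {S′ = S′} {R} step R⊆S′ =
    let (x , y , r , deg) = step⇒removal step
        open LeafEdgeRemoval r
    in x , y ,
       removal-∩ r (x∉p⇒x∈∁p (λ x∈R → x∉S′ (R⊆S′ x∈R)))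
                   (x∉p⇒x∈∁p (λ y∈R → y∉S′ (R⊆S′ y∈R))) ,
       Degree≤1-anti (p∩q⊆p S′ (∁ R)) deg

  removed-isForest : Star (Step G) S R → IsForest G (S ∩ ∁ R)
  removed-isForest {S} ε = subst (IsForest G) (sym (∩-inverseʳ S)) ⊥-isForest
  removed-isForest (step ◅ steps) =
    let (_ , _ , r , deg) = step⇒removal-outside step (reduction-⊆ steps)
    in forest-extend r deg (removed-isForest steps)

  removed-hasUniquePerfectMatching : Star (Step G) S R → HasUniquePerfectMatching G (S ∩ ∁ R)
  removed-hasUniquePerfectMatching {S} ε =
    subst (HasUniquePerfectMatching G) (sym (∩-inverseʳ S)) ⊥-hasUniquePerfectMatching
  removed-hasUniquePerfectMatching (step ◅ steps) =
    let (_ , _ , r , _) = step⇒removal-outside step (reduction-⊆ steps)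
    in removal-hasUniquePerfectMatching r (removed-hasUniquePerfectMatching steps)

lemma4p2 : ∀ {n : ℕ} (G : Graph n) (R : Subset n) → IsResidual G R →
    (IsForest G (∁ R) × HasUniquePerfectMatching G (∁ R)) ×
    (HasPerfectMatching G ⊤ ⇔ HasPerfectMatching G R)
lemma4p2 G R (reduction , _) =
  (subst (IsForest G) ⊤∩∁R≡∁R (removed-isForest G reduction) ,
   subst (HasUniquePerfectMatching G) ⊤∩∁R≡∁R (removed-hasUniquePerfectMatching G reduction)) ,
  reduction-hasPerfectMatching⇔ G reduction
  where
    ⊤∩∁R≡∁R : ⊤ ∩ ∁ R ≡ ∁ R
    ⊤∩∁R≡∁R = ∩-identityˡ (∁ R)
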